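{- Let $D=\max\{|\mathbf{F}|:\mathbf{F}\in\mathcal{F}\}$. Suppose $\rho:d\to k^{\mathsf{u}}$ is a sort and $\gamma,\zeta$ are gluings with sort $\rho$. If $\mathcal{K}(\gamma)\neq\mathcal{K}(\zeta)$, then there are $d_0<D$ and an increasing injection $e:d_0\to d$ with $\mathcal{K}(\gamma^e)\ne\mathcal{K}(\zeta^e)$. In particular, if $\mathrm{ECon}(\rho)\ne\emptyset$, then $d<D$.
   Context: Setting: finite relational language $\mathcal{L}=\{U_i:i<k^{\mathsf{u}}\}\cup\{R_i:i<k\}$ with conventions: each vertex satisfies exactly one $U_i$ ($U(a)=i$); $R_i(a,a)$ never; distinct $a,b$ satisfy exactly one $R_i(a,b)$ ($R(a,b)=i$); an involution $\mathrm{Flip}$ of $k$ fixing $0$ with $R_i(a,b)\iff R_{\mathrm{Flip}(i)}(b,a)$; $R=0$ means no relation. $\mathcal{F}$ is a finite set of finite irreducible structures (irreducible: $R(a,b)\neq0$ for distinct $a,b$), $\mathcal{K}=\mathrm{Forb}(\mathcal{F})$. $\mathbf{K}$ is a fixed enumerated left-dense Fra\"iss\'e limit of $\mathcal{K}$ (underlying set $\omega$; $\mathbf{K}_n$ induced on $\{0,\dots,n-1\}$; left dense: for every enumerated $\mathbf{B}\in\mathcal{K}$ with $|\mathbf{B}|=m+1$, $\mathbf{B}_m=\mathbf{K}_m$, there is an order-preserving embedding fixing $\{0,\dots,m-1\}$ with $R(f(m),r)=0$ for $m\le r<f(m)$). A sort is a map $\rho:d\to k^{\mathsf{u}}$. $\mathcal{L}_d$-structures: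 binary symbols plus unaries $V_0,\dots,V_{d-1}$ partitioning the vertices, underlying set disjoint from $\omega$. A gluing with sort $\rho$ is $\gamma=(\rho,\eta,\mathbf{I})$ with $\mathbf{I}\in\mathcal{K}$ enumerated of size $n$ and $\eta:d\times n\to k$; $\mathbf{B}[\gamma]$ is the $\mathcal{L}$-structure on $\{0,\dots,n-1\}\cup B$ equal to $\mathbf{I}$ on $\{0,\dots,n-1\}$, binary part of $\mathbf{B}$ on $B$, $U(b)=\rho(V(b))$, $R(b,x)=\eta(V(b),x)$; $\mathcal{K}(\gamma)=\{\mathbf{B}\text{ finite}:\mathbf{B}[\gamma]\in\mathcal{K}\}$. For $e:d_0\to d$, $\gamma^e=(\rho\circ e,\eta^e,\mathbf{I})$ with $\eta^e(i,m)=\eta(e(i),m)$. Trees: $T=k^{\mathsf{u}}\times k^{<\omega}$, levels $T(n)$, $\preceq_{lex}$; coding map $c(n)\in T(n)$, $c(n)^{\mathsf{u}}=U(n)$, $c(n)^{\mathsf{b}}(m)=R(n,m)$; $\mathrm{CT}(n)$ = restrictions to level $n$ of coding nodes. For $S=\{s_0\prec_{lex}\dots\prec_{lex}s_{d-1}\}\subseteq T(n)$, $\mathcal{K}(S)=\mathcal{K}(\gamma_S)$ where $\gamma_S=((s_j^{\mathsf{u}})_j,\eta_S,\mathbf{K}_n)$, $\eta_S(j,m)=s_j^{\mathsf{b}}(m)$. $P(\rho)=\{\mathcal{K}(S):S\subseteq\mathrm{CT}(n)\text{ some }n,\ (s_j^{\mathsf{u}})_{j<d}=\rho\}$. For a function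 $e:d_0\to d$ and class $\mathcal{A}$ of $\mathcal{L}_d$-structures, $\mathcal{A}^e=\{\mathbf{B}: e\cdot\mathbf{B}\in\mathcal{A}\}$ where $e\cdot\mathbf{B}$ has the same underlying set and binary part and $V^{e\cdot\mathbf{B}}=e\circ V^{\mathbf{B}}$. $\mathrm{Con}(\rho)$: pairs $(\mathcal{A},\mathcal{B})$ of members of $P(\rho)$ with $\mathcal{B}\subsetneq\mathcal{A}$ and no member of $P(\rho)$ strictly between; $\mathrm{ECon}(\rho)$: those $(\mathcal{A},\mathcal{B})\in\mathrm{Con}(\rho)$ with $\mathcal{A}^{e}=\mathcal{B}^{e}$ for every increasing injection $e:d'\to d$ with $d'<d$. -}

module Defs where

open import Data.Nat as ℕ using (ℕ; zero; suc; _+_; _⊔_)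
open import Data.Fin as Fin using (Fin; zero; suc; toℕ; inject₁; fromℕ; splitAt)
open import Data.Product using (Σ; _×_; _,_; ∃; ∃-syntax; proj₁; proj₂)
open import Data.Sum using (_⊎_; inj₁; inj₂)
open import Data.List using (List; foldr)
open import Data.List.Membership.Propositional using (_∈_)
open import Relation.Binary.PropositionalEquality using (_≡_; _≢_)
open import Relation.Nullary using (¬_)
open import Function using (_∘_)

-- The language: k^u unary symbols, k = suc k0 binary symbols R_0..R_{k-1}
-- (R_0 = "no relation"), and an involution Flip of k fixing 0.

record Lang : Set where
  field
    ku         : ℕ
    k0         : ℕ
    Flip       : Fin (suc k0) → Fin (suc k0)
    Flip-invol : ∀ i → Flip (Flip i) ≡ i
    Flip-zero  : Flip zero ≡ zero

module _ (L : Lang) where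
  open Lang L

  kb : ℕ
  kb = suc k0

  BinWF : ∀ {X : Set} → (X → X → Fin kb) → Set
  BinWF R = (∀ a → R a a ≡ zero) × (∀ a b → R a b ≡ Flip (R b a))

  record LStr (m : ℕ) : Set where
    field
      U : Fin m → Fin ku
      R : Fin m → Fin m → Fin kb
  open LStr public

  WF : ∀ {m} → LStr m → Set
  WF A = BinWF (R A)

  Irreducible : ∀ {m} → LStr m → Set
  Irreducible A = ∀ a b → a ≢ b → R A a b ≢ zero

  IsEmb : ∀ {m} {X : Set} → LStr m → (X → Fin ku) → (X → X → Fin kb) → (Fin m → X) → Set
  IsEmb A UT RT f =
    (∀ a b → f a ≡ f b → a ≡ b) ×
    (∀ a → UT (f a) ≡ U A a) ×
    (∀ a b → RT (f a) (f b) ≡ R A a b)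

  Embeds : ∀ {m n} → LStr m → LStr n → Set
  Embeds A B = ∃[ f ] IsEmb A (U B) (R B) f

  Family : Set
  Family = List (Σ ℕ LStr)

  InK : Family → ∀ {m} → LStr m → Set
  InK 𝓕 A = WF A × (∀ {F} → F ∈ 𝓕 → ¬ Embeds (proj₂ F) A)

  maxSize : Family → ℕ
  maxSize = foldr (λ F acc → proj₁ F ⊔ acc) 0

  -- L_d-structures: binary part plus unaries V_0..V_{d-1} partitioning
  record LdStr (d m : ℕ) : Set where
    field
      V  : Fin m → Fin d
      Rd : Fin m → Fin m → Fin kb
  open LdStr public

  WFd : ∀ {d m} → LdStr d m → Set
  WFd B = BinWF (Rd B)

  Class : ℕ → Set₁
  Class d = (m : ℕ) → LdStr d m → Set

  _≐_ : ∀ {d} → Class d → Class d → Set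
  𝒜 ≐ ℬ = ∀ m B → (𝒜 m B → ℬ m B) × (ℬ m B → 𝒜 m B)

  _⊆_ : ∀ {d} → Class d → Class d → Set
  𝒜 ⊆ ℬ = ∀ m B → 𝒜 m B → ℬ m B

  _⊂_ : ∀ {d} → Class d → Class d → Set
  𝒜 ⊂ ℬ = 𝒜 ⊆ ℬ × ¬ (ℬ ⊆ 𝒜)

  act : ∀ {d0 d m} → (Fin d0 → Fin d) → LdStr d0 m → LdStr d m
  act e B = record { V = e ∘ V B ; Rd = Rd B }

  restrictClass : ∀ {d0 d} → (Fin d0 → Fin d) → Class d → Class d0
  restrictClass e 𝒜 m B = 𝒜 m (act e B)

  Increasing : ∀ {d0 d} → (Fin d0 → Fin d) → Set
  Increasing e = ∀ i j → i Fin.< j → e i Fin.< e j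

  -- B[γ] : universe {0..n-1} ∪ B, realised as Fin (n + m)
  glueR : ∀ {d n m} → (Fin d → Fin n → Fin kb) → LStr n → LdStr d m →
          Fin n ⊎ Fin m → Fin n ⊎ Fin m → Fin kb
  glueR η I B (inj₁ i) (inj₁ j) = R I i j
  glueR η I B (inj₁ i) (inj₂ b) = Flip (η (V B b) i)
  glueR η I B (inj₂ b) (inj₁ i) = η (V B b) i
  glueR η I B (inj₂ b) (inj₂ c) = Rd B b c

  glueU : ∀ {d n m} → (Fin d → Fin ku) → LStr n → LdStr d m → Fin n ⊎ Fin m → Fin ku
  glueU ρ I B (inj₁ i) = U I i
  glueU ρ I B (inj₂ b) = ρ (V B b)

  Glue : ∀ {d n m} → (Fin d → Fin ku) → (Fin d → Fin n → Fin kb) → LStr n →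
         LdStr d m → LStr (n + m)
  Glue {n = n} ρ η I B = record
    { U = λ x → glueU ρ I B (splitAt n x)
    ; R = λ x y → glueR η I B (splitAt n x) (splitAt n y) }

  KOf : Family → ∀ {d} → (Fin d → Fin ku) → (n : ℕ) → (Fin d → Fin n → Fin kb) → LStr n → Class d
  KOf 𝓕 ρ n η I m B = WFd B × InK 𝓕 (Glue ρ η I B)

  record Gluing (𝓕 : Family) {d : ℕ} (ρ : Fin d → Fin ku) : Set where
    field
      n   : ℕ
      η   : Fin d → Fin n → Fin kb
      I   : LStr n
      I∈K : InK 𝓕 I
  open Gluing public

  Kγ : ∀ {𝓕 d} {ρ : Fin d → Fin ku} → Gluing 𝓕 ρ → Class d
  Kγ {𝓕} {ρ = ρ} γ = KOf 𝓕 ρ (n γ) (η γ) (I γ)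

  restrictGluing : ∀ {𝓕 d0 d} {ρ : Fin d → Fin ku} (e : Fin d0 → Fin d) →
                   Gluing 𝓕 ρ → Gluing 𝓕 (ρ ∘ e)
  restrictGluing e γ = record
    { n = n γ ; η = λ i m → η γ (e i) m ; I = I γ ; I∈K = I∈K γ }

  record NStr : Set where
    field
      KU : ℕ → Fin ku
      KR : ℕ → ℕ → Fin kb
  open NStr public

  initSeg : NStr → (n : ℕ) → LStr n
  initSeg K n = record { U = λ i → KU K (toℕ i) ; R = λ i j → KR K (toℕ i) (toℕ j) }

  restrictLast : ∀ {m} → LStr (suc m) → LStr m
  restrictLast B = record { U = λ i → U B (inject₁ i) ; R = λ i j → R B (inject₁ i) (inject₁ j) }

  EmbIntoN : ∀ {m} → LStr m → NStr → (Fin m → ℕ) → Set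
  EmbIntoN A K f = IsEmb A (KU K) (KR K) f

  record IsLeftDenseFraisseLimit (𝓕 : Family) (K : NStr) : Set where
    field
      conventions : BinWF (KR K)
      age⊆K : ∀ {m} (A : LStr m) (f : Fin m → ℕ) → EmbIntoN A K f → InK 𝓕 A
      K⊆age : ∀ {m} (A : LStr m) → InK 𝓕 A → ∃[ f ] EmbIntoN A K f
      extension : ∀ {m} (B : LStr (suc m)) → InK 𝓕 B →
                  (f : Fin m → ℕ) → EmbIntoN (restrictLast B) K f →
                  ∃[ g ] (EmbIntoN B K g × (∀ i → g (inject₁ i) ≡ f i))
      leftDense : ∀ {m} (B : LStr (suc m)) → InK 𝓕 B →
                  (∀ i → U B (inject₁ i) ≡ KU K (toℕ i)) →
                  (∀ i j → R B (inject₁ i) (inject₁ j) ≡ KR K (toℕ i) (toℕ j)) →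
                  ∃[ f ] (EmbIntoN B K f ×
                          (∀ i j → i Fin.< j → f i ℕ.< f j) ×
                          (∀ i → f (inject₁ i) ≡ toℕ i) ×
                          (∀ r → m ℕ.≤ r → r ℕ.< f (fromℕ m) → KR K (f (fromℕ m)) r ≡ zero))

  Node : ℕ → Set
  Node n = Fin ku × (Fin n → Fin kb)

  LexLT : ∀ {n} → (Fin n → Fin kb) → (Fin n → Fin kb) → Set
  LexLT {n} b b' = ∃[ i ] ((∀ j → j Fin.< i → b j ≡ b' j) × b i Fin.< b' i)

  _<lex_ : ∀ {n} → Node n → Node n → Set
  s <lex t = (proj₁ s Fin.< proj₁ t) ⊎ ((proj₁ s ≡ proj₁ t) × LexLT (proj₂ s) (proj₂ t))

  InCT : NStr → (n : ℕ) → Node n → Set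
  InCT K n s = ∃[ m ] (n ℕ.≤ m × proj₁ s ≡ KU K m × (∀ i → proj₂ s i ≡ KR K m (toℕ i)))

  KS : Family → NStr → ∀ {d} (n : ℕ) → (Fin d → Node n) → Class d
  KS 𝓕 K n s = KOf 𝓕 (proj₁ ∘ s) n (λ j m → proj₂ (s j) m) (initSeg K n)

  InP : Family → NStr → ∀ {d} → (Fin d → Fin ku) → Class d → Set
  InP 𝓕 K {d} ρ 𝒜 = ∃[ n ] Σ (Fin d → Node n) λ s →
      (∀ i j → i Fin.< j → s i <lex s j) ×
      (∀ j → InCT K n (s j)) ×
      (∀ j → proj₁ (s j) ≡ ρ j) ×
      (𝒜 ≐ KS 𝓕 K n s)

  Con : Family → NStr → ∀ {d} → (Fin d → Fin ku) → Class d → Class d → Set₁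
  Con 𝓕 K {d} ρ 𝒜 ℬ =
    InP 𝓕 K ρ 𝒜 × InP 𝓕 K ρ ℬ × ℬ ⊂ 𝒜 ×
    ¬ (Σ (Class d) λ 𝒞 → InP 𝓕 K ρ 𝒞 × ℬ ⊂ 𝒞 × 𝒞 ⊂ 𝒜)

  ECon : Family → NStr → ∀ {d} → (Fin d → Fin ku) → Class d → Class d → Set₁
  ECon 𝓕 K {d} ρ 𝒜 ℬ =
    Con 𝓕 K ρ 𝒜 ℬ ×
    (∀ d' → d' ℕ.< d → (e : Fin d' → Fin d) → Increasing e →
       restrictClass e 𝒜 ≐ restrictClass e ℬ)

-- Whether B lies in 𝒦(γ) is decided by the copies of members of 𝓕 inside B[γ].
-- A copy of F that meets the fixed part {0,…,n-1} uses fewer than |F| ≤ D vertices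
-- of B, so it lives in B[γ] restricted to a substructure of B of size below D; a
-- copy that avoids the fixed part only sees B and ρ, hence is the same for every
-- gluing of sort ρ. So two gluings of sort ρ that agree on structures of size
-- below D agree everywhere. Structures of bounded size can be searched
-- exhaustively, so a disagreement is witnessed by some B with fewer than D
-- vertices, and restricting the sort to the colours actually used by B gives an
-- increasing e : d₀ → d with d₀ < D that still separates the two gluings. For
-- the ECon consequence, both classes of a pair in Con(ρ) come from gluings of
-- sort ρ; if d ≥ D the restriction just found would be one of the proper
-- restrictions on which the two classes must agree.
module Submission where

open import Defs
open import Data.Empty using (⊥-elim)
open import Data.Fin using (Fin; zero; suc; toℕ; splitAt; join; punchOut)
import Data.Fin as Fin
open import Data.Fin.Properties
  using (any?; all?; _≟_; <-cmp; injective⇒≤; punchOut-injective; splitAt-join; join-splitAt; toℕ-injective)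
import Data.List as List
open import Data.List.Membership.Propositional using (_∈_)
import Data.List.Relation.Unary.All as All
open import Data.List.Relation.Unary.All using (All)
open import Data.List.Relation.Unary.Any using (here; there)
open import Data.Nat using (ℕ; zero; suc; _<_; _≤_; _<?_; z≤n; s≤s)
import Data.Nat.Properties as ℕ
open import Data.Product using (Σ; _×_; _,_; ∃; ∃-syntax; proj₁; proj₂)
open import Data.Sum using (_⊎_; inj₁; inj₂)
import Data.Sum as Sum
open import Data.Sum.Properties using (inj₂-injective; ≡-dec)
open import Data.Vec.Functional using (_∷_; head; tail)
open import Data.Vec.Functional.Relation.Binary.Pointwise using (Pointwise)
open import Function using (_∘_; id; _⇔_; mk⇔; Equivalence)
open import Function.Definitions using (Injective)
open import Relation.Binary.Definitions using (_Respects_; tri<; tri≈; tri>)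
open import Relation.Binary.PropositionalEquality using (_≡_; _≢_; refl; sym; trans; cong; cong₂; _≗_)
open import Relation.Nullary using (¬_; Dec; yes; no)
open import Relation.Nullary.Decidable using (map′; _×-dec_; _→-dec_; ¬?; decidable-stable)
open import Relation.Unary using (Decidable)

open Equivalence using (to; from)

-- Exhaustive search

-- Predicates on function spaces are only asked to respect pointwise equality,
-- since function extensionality is unavailable.
record Searchable (A : Set) (_≈_ : A → A → Set) : Set₁ where
  field
    ≈-refl : ∀ a → a ≈ a
    search : (P : A → Set) → P Respects _≈_ → Decidable P → Dec (∃ P)

open Searchable

Fin-searchable : ∀ n → Searchable (Fin n) _≡_
Fin-searchable n = record { ≈-refl = λ _ → refl ; search = λ _ _ → any? }

Vector-searchable : ∀ {A _≈_} → Searchable A _≈_ → ∀ p → Searchable (Fin p → A) (Pointwise _≈_)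
Vector-searchable {A} {_≈_} S p = record { ≈-refl = λ f i → ≈-refl S (f i) ; search = search→ p }
  where
  ∷-≈ : ∀ {p x y} {f g : Fin p → A} → x ≈ y → Pointwise _≈_ f g → Pointwise _≈_ (x ∷ f) (y ∷ g)
  ∷-≈ x≈y f≈g zero    = x≈y
  ∷-≈ x≈y f≈g (suc i) = f≈g i

  head∷tail : ∀ {p} (f : Fin (suc p) → A) → Pointwise _≈_ f (head f ∷ tail f)
  head∷tail f zero    = ≈-refl S (f zero)
  head∷tail f (suc i) = ≈-refl S (f (suc i))

  search→ : ∀ p (P : (Fin p → A) → Set) → P Respects Pointwise _≈_ → Decidable P → Dec (∃ P)
  search→ zero P resp P? = map′ (λ q → _ , q) (λ (f , q) → resp (λ ()) q) (P? λ ())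
  search→ (suc p) P resp P? =
    map′ (λ (x , f , q) → x ∷ f , q) (λ (f , q) → head f , tail f , resp (head∷tail f) q)
         (search S (λ x → ∃ λ f → P (x ∷ f)) respHead decHead)
    where
    respHead : (λ x → ∃ λ f → P (x ∷ f)) Respects _≈_
    respHead x≈y (f , q) = f , resp (∷-≈ x≈y (λ i → ≈-refl S (f i))) q
    decHead : Decidable (λ x → ∃ λ f → P (x ∷ f))
    decHead x = search→ p (λ f → P (x ∷ f)) (resp ∘ ∷-≈ (≈-refl S x)) (P? ∘ (x ∷_))

record Enumeration {n} (P : Fin n → Set) : Set where
  field
    size    : ℕ
    at      : Fin size → Fin n
    at-mono : ∀ i j → i Fin.< j → at i Fin.< at j
    at-∈    : ∀ i → P (at i)
    at-onto : ∀ x → P x → ∃ λ i → at i ≡ x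

enumerate : ∀ {n} {P : Fin n → Set} → Decidable P → Enumeration P
enumerate {zero} P? = record { size = 0 ; at = λ () ; at-mono = λ () ; at-∈ = λ () ; at-onto = λ () }
enumerate {suc n} {P} P? with enumerate (P? ∘ suc) | P? zero
... | E | yes P0 = record { size = suc size ; at = zero ∷ (suc ∘ at) ; at-mono = mono ; at-∈ = ∈ ; at-onto = onto }
  where
  open Enumeration E
  mono : ∀ i j → i Fin.< j → (zero ∷ (suc ∘ at)) i Fin.< (zero ∷ (suc ∘ at)) j
  mono zero    (suc j) _         = s≤s z≤n
  mono (suc i) (suc j) (s≤s i<j) = s≤s (at-mono i j i<j)
  ∈ : ∀ i → P ((zero ∷ (suc ∘ at)) i)
  ∈ zero    = P0
  ∈ (suc i) = at-∈ i
  onto : ∀ x → P x → ∃ λ i → (zero ∷ (suc ∘ at)) i ≡ x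
  onto zero    _  = zero , refl
  onto (suc x) Px = let (i , eq) = at-onto x Px in suc i , cong suc eq
... | E | no ¬P0 = record { size = size ; at = suc ∘ at ; at-mono = λ i j i<j → s≤s (at-mono i j i<j) ; at-∈ = at-∈ ; at-onto = onto }
  where
  open Enumeration E
  onto : ∀ x → P x → ∃ λ i → suc (at i) ≡ x
  onto zero    P0 = ⊥-elim (¬P0 P0)
  onto (suc x) Px = let (i , eq) = at-onto x Px in i , cong suc eq

increasing⇒injective : ∀ {m n} {f : Fin m → Fin n} → (∀ i j → i Fin.< j → f i Fin.< f j) → Injective _≡_ _≡_ f
increasing⇒injective {f = f} mono {i} {j} fi≡fj with <-cmp i j
... | tri< i<j _ _ = ⊥-elim (ℕ.<-irrefl (cong toℕ fi≡fj) (mono i j i<j))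
... | tri≈ _ i≡j _ = i≡j
... | tri> _ _ j<i = ⊥-elim (ℕ.<-irrefl (cong toℕ (sym fi≡fj)) (mono j i j<i))

injective-missing⇒< : ∀ {m p} {h : Fin m → Fin p} → Injective _≡_ _≡_ h → ∀ a → (∀ i → h i ≢ a) → m < p
injective-missing⇒< {p = suc p} {h} inj a miss =
  s≤s (injective⇒≤ {f = λ i → punchOut (a≢h i)} (λ eq → inj (punchOut-injective (a≢h _) (a≢h _) eq)))
  where
  a≢h : ∀ i → a ≢ h i
  a≢h i = miss i ∘ sym

map₂-injective : ∀ {A B C : Set} {g : B → C} → Injective _≡_ _≡_ g → Injective _≡_ _≡_ (Sum.map₂ {A = A} g)
map₂-injective inj {inj₁ x} {inj₁ y} refl = refl
map₂-injective inj {inj₂ x} {inj₂ y} eq   = cong inj₂ (inj (inj₂-injective eq))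

map₂-preimage : ∀ {A B C : Set} (g : B → C) (z : A ⊎ C) →
                (∀ c → z ≡ inj₂ c → ∃ λ b → g b ≡ c) → ∃ λ w → Sum.map₂ g w ≡ z
map₂-preimage g (inj₁ a) _    = inj₁ a , refl
map₂-preimage g (inj₂ c) onto = let (b , gb≡c) = onto c refl in inj₂ b , cong inj₂ gb≡c

isInj₁? : ∀ {A B : Set} (z : A ⊎ B) → Dec (∃ λ a → z ≡ inj₁ a)
isInj₁? (inj₁ a) = yes (a , refl)
isInj₁? (inj₂ b) = no λ { (_ , ()) }

¬inj₁⇒inj₂ : ∀ {A B : Set} (z : A ⊎ B) → ¬ (∃ λ a → z ≡ inj₁ a) → ∃ λ b → z ≡ inj₂ b
¬inj₁⇒inj₂ (inj₁ a) ¬inj₁ = ⊥-elim (¬inj₁ (a , refl))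
¬inj₁⇒inj₂ (inj₂ b) _     = b , refl

module _ (L : Lang) where
  open Lang L

  record IsHom {X Y : Set} (UX : X → Fin ku) (RX : X → X → Fin (kb L))
               (UY : Y → Fin ku) (RY : Y → Y → Fin (kb L)) (h : X → Y) : Set where
    field
      hom-U : ∀ x → UY (h x) ≡ UX x
      hom-R : ∀ x x′ → RY (h x) (h x′) ≡ RX x x′

  open IsHom

  module _ {X Y : Set} {UX : X → Fin ku} {RX : X → X → Fin (kb L)}
           {UY : Y → Fin ku} {RY : Y → Y → Fin (kb L)} {h : X → Y}
           (hom : IsHom UX RX UY RY h) {p} {A : LStr L p} where

    IsEmb-∘ : Injective _≡_ _≡_ h → ∀ {f} → IsEmb L A UX RX f → IsEmb L A UY RY (h ∘ f)
    IsEmb-∘ h-inj {f} (f-inj , f-U , f-R) =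
      (λ a b eq → f-inj a b (h-inj eq)) ,
      (λ a → trans (hom-U hom (f a)) (f-U a)) ,
      (λ a b → trans (hom-R hom (f a) (f b)) (f-R a b))

    IsEmb-factor : ∀ {g f} → IsEmb L A UY RY g → (∀ a → h (f a) ≡ g a) → IsEmb L A UX RX f
    IsEmb-factor {g} {f} (g-inj , g-U , g-R) hf≡g =
      (λ a b eq → g-inj a b (trans (sym (hf≡g a)) (trans (cong h eq) (hf≡g b)))) ,
      (λ a → trans (sym (hom-U hom (f a))) (trans (cong UY (hf≡g a)) (g-U a))) ,
      (λ a b → trans (sym (hom-R hom (f a) (f b))) (trans (cong₂ RY (hf≡g a) (hf≡g b)) (g-R a b)))

  id-hom : ∀ {X} {U′ : X → Fin ku} {R′ : X → X → Fin (kb L)} → IsHom U′ R′ U′ R′ id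
  id-hom = record { hom-U = λ _ → refl ; hom-R = λ _ _ → refl }

  BinWF-pullback : ∀ {X Y : Set} {RX : X → X → Fin (kb L)} {RY : Y → Y → Fin (kb L)} {h : X → Y} →
                   (∀ x x′ → RY (h x) (h x′) ≡ RX x x′) → BinWF L RY → BinWF L RX
  BinWF-pullback hom-R (irrefl , flip) =
    (λ x → trans (sym (hom-R x x)) (irrefl _)) ,
    (λ x x′ → trans (sym (hom-R x x′)) (trans (flip _ _) (cong Flip (hom-R x′ x))))

  BinWF? : ∀ {m} (R′ : Fin m → Fin m → Fin (kb L)) → Dec (BinWF L R′)
  BinWF? R′ = all? (λ a → R′ a a ≟ zero) ×-dec all? (λ a → all? (λ b → R′ a b ≟ Flip (R′ b a)))

  Embeds? : ∀ {p q} (F : LStr L p) (A : LStr L q) → Dec (Embeds L F A)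
  Embeds? {p} {q} F A = search (Vector-searchable (Fin-searchable q) p) (IsEmb L F (U A) (R A))
                               (λ f≗g emb → IsEmb-factor (id-hom {U′ = U A} {R′ = R A}) emb (sym ∘ f≗g)) IsEmb?
    where
    IsEmb? : Decidable (IsEmb L F (U A) (R A))
    IsEmb? f = all? (λ a → all? (λ b → (f a ≟ f b) →-dec (a ≟ b)))
         ×-dec all? (λ a → U A (f a) ≟ U F a)
         ×-dec all? (λ a → all? (λ b → R A (f a) (f b) ≟ R F a b))

  module _ (𝓕 : Family L) where

    InKOn : ∀ {X : Set} → (X → Fin ku) → (X → X → Fin (kb L)) → Set
    InKOn U′ R′ = BinWF L R′ × (∀ {F} → F ∈ 𝓕 → ¬ ∃ (IsEmb L (proj₂ F) U′ R′))

    InKOn-pullback : ∀ {X Y : Set} {UX : X → Fin ku} {RX : X → X → Fin (kb L)}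
                     {UY : Y → Fin ku} {RY : Y → Y → Fin (kb L)} {h : X → Y} →
                     IsHom UX RX UY RY h → Injective _≡_ _≡_ h → InKOn UY RY → InKOn UX RX
    InKOn-pullback hom h-inj (wf , forbidden) =
      BinWF-pullback (hom-R hom) wf , λ F∈𝓕 (f , emb) → forbidden F∈𝓕 (_ , IsEmb-∘ hom h-inj emb)

    InK? : ∀ {m} (A : LStr L m) → Dec (InK L 𝓕 A)
    InK? A = BinWF? (R A) ×-dec map′ All.lookup All.tabulate (All.all? (λ F → ¬? (Embeds? (proj₂ F) A)) 𝓕)

  maxSize-≥ : ∀ {𝓕 : Family L} {F} → F ∈ 𝓕 → proj₁ F ≤ maxSize L 𝓕
  maxSize-≥ {G List.∷ 𝓕} (here refl)  = ℕ.m≤m⊔n (proj₁ G) (maxSize L 𝓕)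
  maxSize-≥ {G List.∷ 𝓕} (there F∈𝓕) = ℕ.≤-trans (maxSize-≥ F∈𝓕) (ℕ.m≤n⊔m (proj₁ G) (maxSize L 𝓕))

  -- Gluing

  module _ {d n m} {ρ : Fin d → Fin ku} {η : Fin d → Fin n → Fin (kb L)} {I : LStr L n} {B : LdStr L d m} where

    GlueU : Fin n ⊎ Fin m → Fin ku
    GlueU = glueU L ρ I B
    GlueR : Fin n ⊎ Fin m → Fin n ⊎ Fin m → Fin (kb L)
    GlueR = glueR L η I B

    splitAt-hom : IsHom (U (Glue L ρ η I B)) (R (Glue L ρ η I B)) GlueU GlueR (splitAt n)
    splitAt-hom = record { hom-U = λ _ → refl ; hom-R = λ _ _ → refl }

    join-hom : IsHom GlueU GlueR (U (Glue L ρ η I B)) (R (Glue L ρ η I B)) (join n m)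
    join-hom = record
      { hom-U = λ z → cong GlueU (splitAt-join n m z)
      ; hom-R = λ z w → cong₂ GlueR (splitAt-join n m z) (splitAt-join n m w) }

    inj₂-hom : IsHom (ρ ∘ V B) (Rd B) GlueU GlueR inj₂
    inj₂-hom = record { hom-U = λ _ → refl ; hom-R = λ _ _ → refl }

    KOf⇔ : ∀ {𝓕} → KOf L 𝓕 ρ n η I m B ⇔ (WFd L B × InKOn 𝓕 GlueU GlueR)
    KOf⇔ = mk⇔
      (λ (wf , inK) → wf , InKOn-pullback _ join-hom join-injective inK)
      (λ (wf , inK) → wf , InKOn-pullback _ splitAt-hom splitAt-injective inK)
      where
      join-injective : Injective _≡_ _≡_ (join n m)
      join-injective {z} {w} eq = trans (sym (splitAt-join n m z)) (trans (cong (splitAt n) eq) (splitAt-join n m w))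
      splitAt-injective : Injective _≡_ _≡_ (splitAt n)
      splitAt-injective {x} {y} eq = trans (sym (join-splitAt n m x)) (trans (cong (join n m) eq) (join-splitAt n m y))

  module _ {d n m} {η : Fin d → Fin n → Fin (kb L)} {I : LStr L n} {B : LdStr L d m} where

    glue-WF : WF L I → WFd L B → BinWF L (glueR L η I B)
    glue-WF (I-irrefl , I-flip) (B-irrefl , B-flip) = irrefl , flip
      where
      irrefl : ∀ z → glueR L η I B z z ≡ zero
      irrefl (inj₁ i) = I-irrefl i
      irrefl (inj₂ b) = B-irrefl b
      flip : ∀ z w → glueR L η I B z w ≡ Flip (glueR L η I B w z)
      flip (inj₁ i) (inj₁ j) = I-flip i j
      flip (inj₁ i) (inj₂ b) = refl
      flip (inj₂ b) (inj₁ i) = sym (Flip-invol _)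
      flip (inj₂ b) (inj₂ c) = B-flip b c

  module _ {d d′ n m} {ρ : Fin d → Fin ku} {ρ′ : Fin d′ → Fin ku}
           {η : Fin d → Fin n → Fin (kb L)} {η′ : Fin d′ → Fin n → Fin (kb L)} {I : LStr L n}
           {B : LdStr L d m} {B′ : LdStr L d′ m}
           (ρ≡ : ∀ b → ρ (V B b) ≡ ρ′ (V B′ b)) (η≡ : ∀ b i → η (V B b) i ≡ η′ (V B′ b) i)
           (Rd≡ : ∀ b c → Rd B b c ≡ Rd B′ b c) where

    KOf-cong : ∀ {𝓕} → KOf L 𝓕 ρ n η I m B → KOf L 𝓕 ρ′ n η′ I m B′
    KOf-cong k =
      let (wf , inK) = to KOf⇔ k
      in from KOf⇔ (BinWF-pullback Rd≡ wf , InKOn-pullback _ same-glue (λ eq → eq) inK)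
      where
      same-glue : IsHom (glueU L ρ′ I B′) (glueR L η′ I B′) (glueU L ρ I B) (glueR L η I B) id
      same-glue = record { hom-U = U≡ ; hom-R = R≡ }
        where
        U≡ : ∀ z → glueU L ρ I B z ≡ glueU L ρ′ I B′ z
        U≡ (inj₁ i) = refl
        U≡ (inj₂ b) = ρ≡ b
        R≡ : ∀ z w → glueR L η I B z w ≡ glueR L η′ I B′ z w
        R≡ (inj₁ i) (inj₁ j) = refl
        R≡ (inj₁ i) (inj₂ b) = cong Flip (η≡ b i)
        R≡ (inj₂ b) (inj₁ i) = η≡ b i
        R≡ (inj₂ b) (inj₂ c) = Rd≡ b c

  restrictAlong : ∀ {d m m′} → (Fin m′ → Fin m) → LdStr L d m → LdStr L d m′
  restrictAlong g B = record { V = V B ∘ g ; Rd = λ y y′ → Rd B (g y) (g y′) }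

  module _ {d n m m′} {ρ : Fin d → Fin ku} {η : Fin d → Fin n → Fin (kb L)} {I : LStr L n}
           {B : LdStr L d m} {g : Fin m′ → Fin m} where

    map₂-hom : IsHom (glueU L ρ I (restrictAlong g B)) (glueR L η I (restrictAlong g B))
                     (glueU L ρ I B) (glueR L η I B) (Sum.map₂ g)
    map₂-hom = record { hom-U = U≡ ; hom-R = R≡ }
      where
      U≡ : ∀ z → glueU L ρ I B (Sum.map₂ g z) ≡ glueU L ρ I (restrictAlong g B) z
      U≡ (inj₁ i) = refl
      U≡ (inj₂ b) = refl
      R≡ : ∀ z w → glueR L η I B (Sum.map₂ g z) (Sum.map₂ g w) ≡ glueR L η I (restrictAlong g B) z w
      R≡ (inj₁ i) (inj₁ j) = refl
      R≡ (inj₁ i) (inj₂ b) = refl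
      R≡ (inj₂ b) (inj₁ i) = refl
      R≡ (inj₂ b) (inj₂ c) = refl

    KOf-restrictAlong : ∀ {𝓕} → Injective _≡_ _≡_ g → KOf L 𝓕 ρ n η I m B → KOf L 𝓕 ρ n η I m′ (restrictAlong g B)
    KOf-restrictAlong g-inj k =
      let (wf , inK) = to KOf⇔ k
      in from KOf⇔ (BinWF-pullback (λ _ _ → refl) wf , InKOn-pullback _ map₂-hom (map₂-injective g-inj) inK)

  module _ {d n m p} {ρ : Fin d → Fin ku} {η : Fin d → Fin n → Fin (kb L)} {I : LStr L n}
           {B : LdStr L d m} {F : LStr L p} where

    shrink-embedding : ∀ {f} → IsEmb L F (glueU L ρ I B) (glueR L η I B) f → ∀ {a₀ i₀} → f a₀ ≡ inj₁ i₀ →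
      ∃ λ m′ → m′ < p × Σ (Fin m′ → Fin m) λ g → Injective _≡_ _≡_ g ×
        ∃ (IsEmb L F (glueU L ρ I (restrictAlong g B)) (glueR L η I (restrictAlong g B)))
    shrink-embedding {f} emb {a₀} fa₀≡ =
      size , injective-missing⇒< pick-injective a₀ pick-misses , at , at-injective ,
      f′ , IsEmb-factor map₂-hom emb (λ a → proj₂ (factor a))
      where
      image : Enumeration (λ b → ∃ λ a → f a ≡ inj₂ b)
      image = enumerate (λ b → any? (λ a → ≡-dec _≟_ _≟_ (f a) (inj₂ b)))
      open Enumeration image
      at-injective : Injective _≡_ _≡_ at
      at-injective = increasing⇒injective at-mono
      factor : ∀ a → ∃ λ w → Sum.map₂ at w ≡ f a
      factor a = map₂-preimage at (f a) (λ b fa≡ → at-onto b (a , fa≡))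
      f′ : Fin p → Fin n ⊎ Fin size
      f′ a = proj₁ (factor a)
      pick : Fin size → Fin p
      pick y = proj₁ (at-∈ y)
      pick-injective : Injective _≡_ _≡_ pick
      pick-injective {y} {y′} eq =
        at-injective (inj₂-injective (trans (sym (proj₂ (at-∈ y))) (trans (cong f eq) (proj₂ (at-∈ y′)))))
      pick-misses : ∀ y → pick y ≢ a₀
      pick-misses y eq with trans (sym (proj₂ (at-∈ y))) (trans (cong f eq) fa₀≡)
      ... | ()

  -- Classes of gluings

  _≈ᴸ_ : ∀ {d m} → LdStr L d m → LdStr L d m → Set
  B ≈ᴸ B′ = (V B ≗ V B′) × (∀ b c → Rd B b c ≡ Rd B′ b c)

  ≈ᴸ-sym : ∀ {d m} {B B′ : LdStr L d m} → B ≈ᴸ B′ → B′ ≈ᴸ B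
  ≈ᴸ-sym (V≗ , Rd≡) = sym ∘ V≗ , λ b c → sym (Rd≡ b c)

  LdStr-searchable : ∀ d m → Searchable (LdStr L d m) _≈ᴸ_
  LdStr-searchable d m = record { ≈-refl = λ _ → (λ _ → refl) , (λ _ _ → refl) ; search = searchLd }
    where
    searchLd : (P : LdStr L d m → Set) → P Respects _≈ᴸ_ → Decidable P → Dec (∃ P)
    searchLd P resp P? =
      map′ (λ (v , r , q) → _ , q) (λ (B , q) → V B , Rd B , q)
           (search (Vector-searchable (Fin-searchable d) m) (λ v → ∃ λ r → P (record { V = v ; Rd = r }))
                   (λ v≗ (r , q) → r , resp (v≗ , λ _ _ → refl) q) decV)
      where
      decV : Decidable (λ v → ∃ λ r → P (record { V = v ; Rd = r }))
      decV v = search (Vector-searchable (Vector-searchable (Fin-searchable (kb L)) m) m)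
                      (λ r → P (record { V = v ; Rd = r })) (λ r≗ → resp ((λ _ → refl) , r≗)) (P? ∘ _)

  ≐-sym : ∀ {d} {𝒜 ℬ : Class L d} → _≐_ L 𝒜 ℬ → _≐_ L ℬ 𝒜
  ≐-sym 𝒜≐ℬ m B = let (to′ , from′) = 𝒜≐ℬ m B in from′ , to′

  ≐-trans : ∀ {d} {𝒜 ℬ 𝒞 : Class L d} → _≐_ L 𝒜 ℬ → _≐_ L ℬ 𝒞 → _≐_ L 𝒜 𝒞
  ≐-trans 𝒜≐ℬ ℬ≐𝒞 m B = proj₁ (ℬ≐𝒞 m B) ∘ proj₁ (𝒜≐ℬ m B) , proj₂ (𝒜≐ℬ m B) ∘ proj₂ (ℬ≐𝒞 m B)

  restrictClass-cong : ∀ {d₀ d} (e : Fin d₀ → Fin d) {𝒜 ℬ : Class L d} →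
                       _≐_ L 𝒜 ℬ → _≐_ L (restrictClass L e 𝒜) (restrictClass L e ℬ)
  restrictClass-cong e 𝒜≐ℬ m B = 𝒜≐ℬ m (act L e B)

  module _ {𝓕 : Family L} {d} {ρ : Fin d → Fin ku} where

    Kγ? : (γ : Gluing L 𝓕 ρ) → ∀ {m} (B : LdStr L d m) → Dec (Kγ L γ m B)
    Kγ? γ B = BinWF? (Rd B) ×-dec InK? 𝓕 (Glue L ρ (η γ) (I γ) B)

    Kγ⇔ : (γ : Gluing L 𝓕 ρ) → ∀ {m} {B : LdStr L d m} →
          Kγ L γ m B ⇔ (WFd L B × InKOn 𝓕 (glueU L ρ (I γ) B) (glueR L (η γ) (I γ) B))
    Kγ⇔ γ = KOf⇔

    Kγ-resp : (γ : Gluing L 𝓕 ρ) → ∀ {m} → Kγ L γ m Respects _≈ᴸ_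
    Kγ-resp γ (V≗ , Rd≡) = KOf-cong (cong ρ ∘ V≗) (λ b i → cong (λ c → η γ c i) (V≗ b)) Rd≡

    Kγ-restrict : ∀ {d₀} (e : Fin d₀ → Fin d) (γ : Gluing L 𝓕 ρ) →
                  _≐_ L (Kγ L (restrictGluing L e γ)) (restrictClass L e (Kγ L γ))
    Kγ-restrict e γ m B = KOf-cong (λ _ → refl) (λ _ _ → refl) (λ _ _ → refl) ,
                          KOf-cong (λ _ → refl) (λ _ _ → refl) (λ _ _ → refl)

    ⊆-from-small : (γ ζ : Gluing L 𝓕 ρ) →
                   (∀ m → m < maxSize L 𝓕 → ∀ B → Kγ L γ m B → Kγ L ζ m B) → _⊆_ L (Kγ L γ) (Kγ L ζ)
    ⊆-from-small γ ζ small m B kγ = from (Kγ⇔ ζ) (wf , glue-WF (proj₁ (I∈K ζ)) wf , forbidden)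
      where
      wf : WFd L B
      wf = proj₁ (to (Kγ⇔ γ) kγ)
      γ-forbidden : ∀ {F} → F ∈ 𝓕 → ¬ ∃ (IsEmb L (proj₂ F) (glueU L ρ (I γ) B) (glueR L (η γ) (I γ) B))
      γ-forbidden = proj₂ (proj₂ (to (Kγ⇔ γ) kγ))
      forbidden : ∀ {F} → F ∈ 𝓕 → ¬ ∃ (IsEmb L (proj₂ F) (glueU L ρ (I ζ) B) (glueR L (η ζ) (I ζ) B))
      forbidden {p , F} F∈𝓕 (f , emb) with any? (isInj₁? ∘ f)
      ... | no missesI = γ-forbidden F∈𝓕 (inj₂ ∘ g , IsEmb-∘ (inj₂-hom {ρ = ρ} {η γ} {I γ} {B}) inj₂-injective
                                                   (IsEmb-factor (inj₂-hom {ρ = ρ} {η ζ} {I ζ} {B}) emb (sym ∘ f≡)))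
        where
        g : Fin p → Fin m
        g a = proj₁ (¬inj₁⇒inj₂ (f a) (missesI ∘ (a ,_)))
        f≡ : ∀ a → f a ≡ inj₂ (g a)
        f≡ a = proj₂ (¬inj₁⇒inj₂ (f a) (missesI ∘ (a ,_)))
      ... | yes (a₀ , i₀ , fa₀≡) =
        let (m′ , m′<p , g , g-inj , emb′) = shrink-embedding emb fa₀≡
            kζ = small m′ (ℕ.<-≤-trans m′<p (maxSize-≥ F∈𝓕)) (restrictAlong g B) (KOf-restrictAlong g-inj kγ)
        in proj₂ (proj₂ (to (Kγ⇔ ζ) kζ)) F∈𝓕 emb′

  record SortCompression {d m} (B : LdStr L d m) : Set where
    field
      d₀      : ℕ
      d₀≤m    : d₀ ≤ m
      e       : Fin d₀ → Fin d
      e-mono  : Increasing L e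
      B₀      : LdStr L d₀ m
      act-B₀  : act L e B₀ ≈ᴸ B

  compressSorts : ∀ {d m} (B : LdStr L d m) → SortCompression B
  compressSorts {d} {m} B = record
    { d₀ = size ; d₀≤m = injective⇒≤ pick-injective ; e = at ; e-mono = at-mono
    ; B₀ = record { V = λ b → proj₁ (colour b) ; Rd = Rd B }
    ; act-B₀ = (λ b → proj₂ (colour b)) , (λ _ _ → refl) }
    where
    used : Enumeration (λ c → ∃ λ b → V B b ≡ c)
    used = enumerate (λ c → any? (λ b → V B b ≟ c))
    open Enumeration used
    colour : ∀ b → ∃ λ i → at i ≡ V B b
    colour b = at-onto (V B b) (b , refl)
    pick-injective : Injective _≡_ _≡_ (λ i → proj₁ (at-∈ i))
    pick-injective {i} {j} eq =
      increasing⇒injective at-mono (trans (sym (proj₂ (at-∈ i))) (trans (cong (V B) eq) (proj₂ (at-∈ j))))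

  module _ {𝓕 : Family L} where

    record Separates {d} {ρ : Fin d → Fin ku} (γ ζ : Gluing L 𝓕 ρ) m (B : LdStr L d m) : Set where
      constructor separates
      field
        ∈γ : Kγ L γ m B
        ∉ζ : ¬ Kγ L ζ m B

    separates⇒≉ : ∀ {d} {ρ : Fin d → Fin ku} {γ ζ : Gluing L 𝓕 ρ} {m B} →
                  Separates γ ζ m B → ¬ _≐_ L (Kγ L γ) (Kγ L ζ)
    separates⇒≉ {m = m} {B} (separates kγ ¬kζ) γ≐ζ = ¬kζ (proj₁ (γ≐ζ m B) kγ)

    DistinguishedBelow : ℕ → ∀ {d} {ρ : Fin d → Fin ku} (γ ζ : Gluing L 𝓕 ρ) → Set
    DistinguishedBelow D {d} γ ζ = ∃[ d₀ ] (d₀ < D × Σ (Fin d₀ → Fin d) λ e → Increasing L e ×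
      ¬ _≐_ L (Kγ L (restrictGluing L e γ)) (Kγ L (restrictGluing L e ζ)))

    module _ {d} {ρ : Fin d → Fin ku} where

      ⊆-or-small-separator : (γ ζ : Gluing L 𝓕 ρ) →
        _⊆_ L (Kγ L γ) (Kγ L ζ) ⊎ ∃ λ m → m < maxSize L 𝓕 × ∃ (Separates γ ζ m)
      ⊆-or-small-separator γ ζ with ℕ.anyUpTo? separator? (maxSize L 𝓕)
        where
        separator? : Decidable (λ m → ∃ (Separates γ ζ m))
        separator? m = search (LdStr-searchable d m) (Separates γ ζ m)
          (λ B≈B′ (separates kγ ¬kζ) → separates (Kγ-resp γ B≈B′ kγ) (¬kζ ∘ Kγ-resp ζ (≈ᴸ-sym B≈B′)))
          (λ B → map′ (λ (kγ , ¬kζ) → separates kγ ¬kζ) (λ (separates kγ ¬kζ) → kγ , ¬kζ) (Kγ? γ B ×-dec ¬? (Kγ? ζ B)))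
      ... | yes separator = inj₂ separator
      ... | no ¬separator = inj₁ (⊆-from-small γ ζ λ m m<D B kγ →
              decidable-stable (Kγ? ζ B) (λ ¬kζ → ¬separator (m , m<D , B , separates kγ ¬kζ)))

      restrict-separator : {γ ζ : Gluing L 𝓕 ρ} → ∀ {m B} → Separates γ ζ m B →
        let open SortCompression (compressSorts B)
        in Separates (restrictGluing L e γ) (restrictGluing L e ζ) m B₀
      restrict-separator {γ} {ζ} {m} {B} (separates kγ ¬kζ) = separates
        (proj₂ (Kγ-restrict e γ m B₀) (Kγ-resp γ (≈ᴸ-sym act-B₀) kγ))
        (¬kζ ∘ Kγ-resp ζ act-B₀ ∘ proj₁ (Kγ-restrict e ζ m B₀))
        where
        open SortCompression (compressSorts B)

      distinct⇒distinguishedBelow : (γ ζ : Gluing L 𝓕 ρ) → ¬ _≐_ L (Kγ L γ) (Kγ L ζ) →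
                                    DistinguishedBelow (maxSize L 𝓕) γ ζ
      distinct⇒distinguishedBelow γ ζ γ≉ζ with ⊆-or-small-separator γ ζ | ⊆-or-small-separator ζ γ
      ... | inj₂ (m , m<D , B , sep) | _ =
        let open SortCompression (compressSorts B)
        in d₀ , ℕ.≤-<-trans d₀≤m m<D , e , e-mono , separates⇒≉ (restrict-separator sep)
      ... | inj₁ _ | inj₂ (m , m<D , B , sep) =
        let open SortCompression (compressSorts B)
        in d₀ , ℕ.≤-<-trans d₀≤m m<D , e , e-mono , separates⇒≉ (restrict-separator sep) ∘ ≐-sym
      ... | inj₁ γ⊆ζ | inj₁ ζ⊆γ = ⊥-elim (γ≉ζ λ m B → γ⊆ζ m B , ζ⊆γ m B)

  -- Classes in P(ρ)

  module _ {𝓕 : Family L} {K : NStr L} (limit : IsLeftDenseFraisseLimit L 𝓕 K) {d} {ρ : Fin d → Fin ku} where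

    initSeg∈K : ∀ n → InK L 𝓕 (initSeg L K n)
    initSeg∈K n = IsLeftDenseFraisseLimit.age⊆K limit (initSeg L K n) toℕ
                    ((λ _ _ → toℕ-injective) , (λ _ → refl) , (λ _ _ → refl))

    P⇒gluing : ∀ {𝒜} → InP L 𝓕 K ρ 𝒜 → Σ (Gluing L 𝓕 ρ) λ γ → _≐_ L 𝒜 (Kγ L γ)
    P⇒gluing (n , s , _ , _ , sort≡ , 𝒜≐) = γ , ≐-trans 𝒜≐ λ m B →
        KOf-cong (sort≡ ∘ V B) (λ _ _ → refl) (λ _ _ → refl) ,
        KOf-cong (sym ∘ sort≡ ∘ V B) (λ _ _ → refl) (λ _ _ → refl)
      where
      γ : Gluing L 𝓕 ρ
      γ = record { n = n ; η = λ j i → proj₂ (s j) i ; I = initSeg L K n ; I∈K = initSeg∈K n }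

    ECon⇒sort<D : (Σ (Class L d) λ 𝒜 → Σ (Class L d) λ ℬ → ECon L 𝓕 K ρ 𝒜 ℬ) → d < maxSize L 𝓕
    ECon⇒sort<D (𝒜 , ℬ , (𝒜∈P , ℬ∈P , (_ , 𝒜⊈ℬ) , _) , agree-below) with d <? maxSize L 𝓕
    ... | yes d<D = d<D
    ... | no d≮D =
      let (γ , 𝒜≐γ) = P⇒gluing 𝒜∈P
          (ζ , ℬ≐ζ) = P⇒gluing ℬ∈P
          γ≉ζ : ¬ _≐_ L (Kγ L γ) (Kγ L ζ)
          γ≉ζ γ≐ζ = 𝒜⊈ℬ λ m B → proj₂ (≐-trans ℬ≐ζ (≐-sym (≐-trans 𝒜≐γ γ≐ζ)) m B)
          (d₀ , d₀<D , e , e-mono , γᵉ≉ζᵉ) = distinct⇒distinguishedBelow γ ζ γ≉ζ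
          𝒜ᵉ≐ℬᵉ = agree-below d₀ (ℕ.<-≤-trans d₀<D (ℕ.≮⇒≥ d≮D)) e e-mono
      in ⊥-elim (γᵉ≉ζᵉ (≐-trans (Kγ-restrict e γ) (≐-trans (restrictClass-cong e (≐-sym 𝒜≐γ))
                   (≐-trans 𝒜ᵉ≐ℬᵉ (≐-trans (restrictClass-cong e ℬ≐ζ) (≐-sym (Kγ-restrict e ζ)))))))

lemma8p3 : (L : Lang) (𝓕 : Family L) →
    All (λ F → WF L (proj₂ F) × Irreducible L (proj₂ F)) 𝓕 →
    ((d : ℕ) (ρ : Fin d → Fin (Lang.ku L)) (γ ζ : Gluing L 𝓕 ρ) →
       ¬ (_≐_ L (Kγ L γ) (Kγ L ζ)) →
       ∃[ d0 ] (d0 < maxSize L 𝓕 × (Σ (Fin d0 → Fin d) λ e → Increasing L e ×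
         ¬ (_≐_ L (Kγ L (restrictGluing L e γ)) (Kγ L (restrictGluing L e ζ))))))
    ×
    ((K : NStr L) → IsLeftDenseFraisseLimit L 𝓕 K →
     (d : ℕ) (ρ : Fin d → Fin (Lang.ku L)) →
       (Σ (Class L d) λ 𝒜 → Σ (Class L d) λ ℬ → ECon L 𝓕 K ρ 𝒜 ℬ) →
       d < maxSize L 𝓕)
-- Neither irreducibility nor the conventions on the members of 𝓕 are needed.
lemma8p3 L 𝓕 _ =
  (λ d ρ → distinct⇒distinguishedBelow L {𝓕} {d} {ρ}) ,
  (λ K limit d ρ → ECon⇒sort<D L limit {d} {ρ})
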